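{- Let $A,B$ be evolving cycles and $n\ge4$. Then $n$ is an isolated vertex of the pedigree graph $G^{AB}_n$ if and only if both (1) $\nu_A(n)$ is a cycle-edge of $B_n$, and (2) $\nu_B(n)$ is a cycle-edge of $A_n$.
   Context: For $m\ge 3$, a cycle on $[m]=\{1,\dots,m\}$ is an undirected Hamiltonian cycle with node set $[m]$; its edges are cycle-edges. An evolving cycle is a sequence $A=(A_m)_{m\ge3}$ where $A_3$ is the unique cycle on $\{1,2,3\}$ and $A_m$ ($m\ge4$) is obtained from $A_{m-1}$ by inserting node $m$ into one cycle-edge of $A_{m-1}$. For $m\ge4$, $\nu_A(m)$ is the set of the two neighbours of $m$ in $A_m$; $\nu_A(3)=\{1,2\}$, $\nu_A(2)=\{1\}$, $\nu_A(1)=\emptyset$; similarly for $B$. The pedigree graph $G^{AB}_n$ has vertex set $\{m\in\{4,\dots,n\}:\nu_A(m)\neq\nu_B(m)\}$; for vertices $k<m$, $\{k,m\}$ is an edge iff at least one holds: (i) $\nu_A(m)=\nu_B(k)$; (ii) $\nu_B(m)=\nu_A(k)$; (iii) $k=\max\nu_A(m)$ and $\nu_B(k)\cap\nu_A(m)=\emptyset$; (iv) $k=\max\nu_B(m)$ and $\nu_A(k)\cap\nu_B(m)=\emptyset$. -}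

module Defs where

open import Data.Nat using (ℕ; zero; suc; pred; _≤_; _<_)
open import Data.Product using (_×_; _,_; proj₁; proj₂; ∃-syntax)
open import Data.Sum using (_⊎_)
open import Data.Empty using (⊥)
open import Relation.Nullary using (¬_)
open import Relation.Binary.PropositionalEquality using (_≡_; _≢_)

NSet : Set₁
NSet = ℕ → Set

_≐_ : NSet → NSet → Set
P ≐ Q = ∀ x → (P x → Q x) × (Q x → P x)

Disjoint : NSet → NSet → Set
Disjoint P Q = ∀ x → P x → Q x → ⊥

IsMax : ℕ → NSet → Set
IsMax k P = P k × (∀ x → P x → x ≤ k)

Pair : ℕ → ℕ → NSet
Pair a b x = (x ≡ a) ⊎ (x ≡ b)

SameEdge : ℕ × ℕ → ℕ → ℕ → Set
SameEdge (a , b) x y = ((x ≡ a) × (y ≡ b)) ⊎ ((x ≡ b) × (y ≡ a))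

In123 : ℕ → Set
In123 x = (x ≡ 1) ⊎ (x ≡ 2) ⊎ (x ≡ 3)

-- Cycle-edges of the evolving cycle determined by insertion choices `ins`:
-- ins m = endpoints of the cycle-edge of A_{m-1} into which node m is inserted (m ≥ 4).
-- CEdge ins m x y  ⇔  {x,y} is a cycle-edge of A_m.
CEdge : (ℕ → ℕ × ℕ) → ℕ → ℕ → ℕ → Set
CEdge ins zero x y = ⊥
CEdge ins (suc zero) x y = ⊥
CEdge ins (suc (suc zero)) x y = ⊥
CEdge ins (suc (suc (suc zero))) x y = In123 x × In123 y × x ≢ y
CEdge ins (suc m@(suc (suc (suc _)))) x y =
    (CEdge ins m x y × ¬ SameEdge (ins (suc m)) x y)
  ⊎ ((x ≡ suc m) × Pair (proj₁ (ins (suc m))) (proj₂ (ins (suc m))) y)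
  ⊎ ((y ≡ suc m) × Pair (proj₁ (ins (suc m))) (proj₂ (ins (suc m))) x)

record EvolvingCycle : Set where
  field
    ins   : ℕ → ℕ × ℕ
    valid : ∀ m → 4 ≤ m → CEdge ins (pred m) (proj₁ (ins m)) (proj₂ (ins m))

open EvolvingCycle public

IsCycleEdge : EvolvingCycle → ℕ → ℕ → ℕ → Set
IsCycleEdge A m x y = CEdge (ins A) m x y

ν : EvolvingCycle → ℕ → NSet
ν A zero x = ⊥
ν A (suc zero) x = ⊥
ν A (suc (suc zero)) x = x ≡ 1
ν A m@(suc (suc (suc _))) x = IsCycleEdge A m m x

SetIsCycleEdge : EvolvingCycle → ℕ → NSet → Set
SetIsCycleEdge A m S = ∃[ x ] ∃[ y ] (S ≐ Pair x y × IsCycleEdge A m x y)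

IsVertex : EvolvingCycle → EvolvingCycle → ℕ → ℕ → Set
IsVertex A B n m = 4 ≤ m × m ≤ n × ¬ (ν A m ≐ ν B m)

-- adjacency condition for k < m (conditions (i)-(iv))
AdjCond : EvolvingCycle → EvolvingCycle → ℕ → ℕ → Set
AdjCond A B k m =
    (ν A m ≐ ν B k)
  ⊎ (ν B m ≐ ν A k)
  ⊎ (IsMax k (ν A m) × Disjoint (ν B k) (ν A m))
  ⊎ (IsMax k (ν B m) × Disjoint (ν A k) (ν B m))

PedEdge : EvolvingCycle → EvolvingCycle → ℕ → ℕ → ℕ → Set
PedEdge A B n k m = k < m × IsVertex A B n k × IsVertex A B n m × AdjCond A B k m

Isolated : EvolvingCycle → EvolvingCycle → ℕ → ℕ → Set
Isolated A B n m =
  IsVertex A B n m × (∀ k → ¬ PedEdge A B n k m) × (∀ k → ¬ PedEdge A B n m k)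

-- A cycle-edge of A_j survives in every later A_m until a node k is inserted into it, and
-- then never reappears; hence ν_A(k), the edge split at k ≥ 4, is a cycle-edge of A_{k-1}
-- but of no A_m with m ≥ k.
-- (⇐) A cycle-edge S = ν_A(n) of B_n is therefore no ν_B(k) with k ≤ n, which excludes
-- (i) and the vertex condition; and the other end of the larger node k of S is a
-- neighbour of k in B_k, which excludes (iii). Conditions (ii), (iv) are symmetric.
-- (⇒) Write ν_A(n) = {lo,hi} with lo < hi. It is a cycle-edge of B_3 = A_3 if hi ≤ 3, and
-- of B_hi if lo ∈ ν_B(hi); otherwise hi, a vertex because lo ∈ ν_A(hi), would be adjacent
-- to n by (iii). Were it split in B at some k ≤ n, then ν_B(k) = ν_A(n), so either n is
-- not a vertex or k is adjacent to n by (i). Hence it persists to B_n.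
module Submission where

open import Defs
open import Data.Nat
  using (ℕ; suc; pred; _≤_; _<_; _≤′_; ≤′-refl; ≤′-step; z≤n; s≤s; _≟_; _≤?_)
open import Data.Nat.Properties
  using (≤-refl; ≤-trans; <⇒≤; <⇒≱; ≰⇒>; 1+n≰n; m≤n⇒m≤1+n; m≤n⇒m<n∨m≡n;
         <-≤-trans; <-cmp; <⇒≤pred; pred-mono-≤; ≤⇒≤′; ≤′⇒≤)
open import Data.Product using (_×_; _,_; proj₁; proj₂; ∃-syntax)
open import Data.Sum using (inj₁; inj₂)
open import Data.Empty using (⊥-elim)
open import Relation.Nullary using (¬_; Dec; yes; no)
open import Relation.Nullary.Decidable using (map′; _⊎-dec_)
open import Relation.Binary.Definitions using (tri<; tri≈; tri>)
open import Relation.Binary.PropositionalEquality using (_≢_; refl)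
open import Function.Bundles using (_⇔_; mk⇔)

pattern 3+ n = suc (suc (suc n))
pattern 3≤3+n = s≤s (s≤s (s≤s z≤n))

≐-sym : ∀ {P Q} → P ≐ Q → Q ≐ P
≐-sym P≐Q x = proj₂ (P≐Q x) , proj₁ (P≐Q x)

≐-trans : ∀ {P Q R} → P ≐ Q → Q ≐ R → P ≐ R
≐-trans P≐Q Q≐R x = (λ p → proj₁ (Q≐R x) (proj₁ (P≐Q x) p))
                  , (λ r → proj₂ (P≐Q x) (proj₂ (Q≐R x) r))

Pair-comm : ∀ {a b} → Pair a b ≐ Pair b a
Pair-comm x = swap , swap
  where
  swap : ∀ {a b} → Pair a b x → Pair b a x
  swap (inj₁ x≡a) = inj₂ x≡a
  swap (inj₂ x≡b) = inj₁ x≡b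

Pair-≤ : ∀ {a b k z} → a ≤ k × b ≤ k → Pair a b z → z ≤ k
Pair-≤ (a≤k , _) (inj₁ refl) = a≤k
Pair-≤ (_ , b≤k) (inj₂ refl) = b≤k

SameEdge-sym : ∀ {p x y} → SameEdge p x y → SameEdge p y x
SameEdge-sym (inj₁ (x≡ , y≡)) = inj₂ (y≡ , x≡)
SameEdge-sym (inj₂ (x≡ , y≡)) = inj₁ (y≡ , x≡)

SameEdge⇒Pair≐ : ∀ {p x y} → SameEdge p x y → Pair (proj₁ p) (proj₂ p) ≐ Pair x y
SameEdge⇒Pair≐ (inj₁ (refl , refl)) x = (λ z → z) , (λ z → z)
SameEdge⇒Pair≐ (inj₂ (refl , refl)) = Pair-comm

Pair≐⇒SameEdge : ∀ {p x y} → x ≢ y → Pair x y ≐ Pair (proj₁ p) (proj₂ p) → SameEdge p x y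
Pair≐⇒SameEdge {x = x} {y} x≢y eq with proj₁ (eq x) (inj₁ refl) | proj₁ (eq y) (inj₂ refl)
... | inj₁ refl | inj₁ refl = ⊥-elim (x≢y refl)
... | inj₁ refl | inj₂ refl = inj₁ (refl , refl)
... | inj₂ refl | inj₁ refl = inj₂ (refl , refl)
... | inj₂ refl | inj₂ refl = ⊥-elim (x≢y refl)

In123⇒≤3 : ∀ {x} → In123 x → x ≤ 3
In123⇒≤3 (inj₁ refl) = s≤s z≤n
In123⇒≤3 (inj₂ (inj₁ refl)) = s≤s (s≤s z≤n)
In123⇒≤3 (inj₂ (inj₂ refl)) = ≤-refl

module _ (A : EvolvingCycle) where

  SplitEdge : ℕ → NSet
  SplitEdge m = Pair (proj₁ (ins A m)) (proj₂ (ins A m))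

  cycleEdge-bounded : ∀ m {x y} → IsCycleEdge A m x y → x ≤ m × y ≤ m
  splitEdge-≤ : ∀ m {z} → 3 ≤ m → SplitEdge (suc m) z → z ≤ m

  splitEdge-≤ m 3≤m = Pair-≤ (cycleEdge-bounded m (valid A (suc m) (s≤s 3≤m)))

  cycleEdge-bounded 3 (x∈ , y∈ , _) = In123⇒≤3 x∈ , In123⇒≤3 y∈
  cycleEdge-bounded (suc m@(3+ _)) (inj₁ (e , _)) =
    m≤n⇒m≤1+n (proj₁ (cycleEdge-bounded m e)) , m≤n⇒m≤1+n (proj₂ (cycleEdge-bounded m e))
  cycleEdge-bounded (suc m@(3+ _)) (inj₂ (inj₁ (refl , y∈))) =
    ≤-refl , m≤n⇒m≤1+n (splitEdge-≤ m 3≤3+n y∈)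
  cycleEdge-bounded (suc m@(3+ _)) (inj₂ (inj₂ (refl , x∈))) =
    m≤n⇒m≤1+n (splitEdge-≤ m 3≤3+n x∈) , ≤-refl

  splitEdge-< : ∀ {k z} → 4 ≤ k → SplitEdge k z → z < k
  splitEdge-< (s≤s 3≤k) z∈ = s≤s (splitEdge-≤ _ 3≤k z∈)

  cycleEdge-irrefl : ∀ m {x} → ¬ IsCycleEdge A m x x
  cycleEdge-irrefl 3 (_ , _ , x≢x) = x≢x refl
  cycleEdge-irrefl (suc m@(3+ _)) (inj₁ (e , _)) = cycleEdge-irrefl m e
  cycleEdge-irrefl (suc m@(3+ _)) (inj₂ (inj₁ (refl , x∈))) = 1+n≰n (splitEdge-≤ m 3≤3+n x∈)
  cycleEdge-irrefl (suc m@(3+ _)) (inj₂ (inj₂ (refl , x∈))) = 1+n≰n (splitEdge-≤ m 3≤3+n x∈)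

  cycleEdge-sym : ∀ m {x y} → IsCycleEdge A m x y → IsCycleEdge A m y x
  cycleEdge-sym 3 (x∈ , y∈ , x≢y) = y∈ , x∈ , λ { refl → x≢y refl }
  cycleEdge-sym (suc m@(3+ _)) (inj₁ (e , unsplit)) =
    inj₁ (cycleEdge-sym m e , λ same → unsplit (SameEdge-sym same))
  cycleEdge-sym (suc (3+ _)) (inj₂ (inj₁ e)) = inj₂ (inj₂ e)
  cycleEdge-sym (suc (3+ _)) (inj₂ (inj₂ e)) = inj₂ (inj₁ e)

  cycleEdge-step : ∀ {m x y} → 3 ≤ m → IsCycleEdge A m x y →
    ¬ SameEdge (ins A (suc m)) x y → IsCycleEdge A (suc m) x y
  cycleEdge-step (s≤s (s≤s (s≤s _))) e unsplit = inj₁ (e , unsplit)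

  cycleEdge-step⁻ : ∀ {m x y} → 3 ≤ m → x ≤ m → y ≤ m → IsCycleEdge A (suc m) x y →
    IsCycleEdge A m x y × ¬ SameEdge (ins A (suc m)) x y
  cycleEdge-step⁻ (s≤s (s≤s (s≤s _))) _ _ (inj₁ old) = old
  cycleEdge-step⁻ (s≤s (s≤s (s≤s _))) x≤m _ (inj₂ (inj₁ (refl , _))) =
    ⊥-elim (1+n≰n x≤m)
  cycleEdge-step⁻ (s≤s (s≤s (s≤s _))) _ y≤m (inj₂ (inj₂ (refl , _))) =
    ⊥-elim (1+n≰n y≤m)

  cycleEdge-persist : ∀ {j m x y} → 3 ≤ j → j ≤ m → IsCycleEdge A j x y →
    (∀ {k} → j < k → k ≤ m → ¬ SameEdge (ins A k) x y) → IsCycleEdge A m x y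
  cycleEdge-persist {j} {x = x} {y} 3≤j j≤m e = go (≤⇒≤′ j≤m)
    where
    go : ∀ {m} → j ≤′ m → (∀ {k} → j < k → k ≤ m → ¬ SameEdge (ins A k) x y) →
      IsCycleEdge A m x y
    go ≤′-refl _ = e
    go (≤′-step j≤′m) unsplit =
      cycleEdge-step (≤-trans 3≤j (≤′⇒≤ j≤′m))
        (go j≤′m (λ j<k k≤m → unsplit j<k (m≤n⇒m≤1+n k≤m)))
        (unsplit (s≤s (≤′⇒≤ j≤′m)) ≤-refl)

  cycleEdge-restrict : ∀ {j m x y} → 3 ≤ j → j ≤ m → x ≤ j → y ≤ j →
    IsCycleEdge A m x y → IsCycleEdge A j x y
  cycleEdge-restrict {j} {x = x} {y} 3≤j j≤m x≤j y≤j = go (≤⇒≤′ j≤m)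
    where
    go : ∀ {m} → j ≤′ m → IsCycleEdge A m x y → IsCycleEdge A j x y
    go ≤′-refl e = e
    go (≤′-step j≤′m) e =
      let j≤m = ≤′⇒≤ j≤′m in
      go j≤′m (proj₁ (cycleEdge-step⁻ (≤-trans 3≤j j≤m) (≤-trans x≤j j≤m)
                                      (≤-trans y≤j j≤m) e))

  cycleEdge-unsplit : ∀ {k m x y} → 4 ≤ k → k ≤ m → IsCycleEdge A m x y →
    ¬ SameEdge (ins A k) x y
  cycleEdge-unsplit {suc k} {x = x} {y} 4≤k@(s≤s 3≤k) k≤m e same =
    proj₂ (cycleEdge-step⁻ 3≤k x≤k y≤k
            (cycleEdge-restrict (<⇒≤ 4≤k) k≤m (m≤n⇒m≤1+n x≤k) (m≤n⇒m≤1+n y≤k) e))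
          same
    where
    x≤k : x ≤ k
    x≤k = splitEdge-≤ k 3≤k (proj₂ (SameEdge⇒Pair≐ same x) (inj₁ refl))
    y≤k : y ≤ k
    y≤k = splitEdge-≤ k 3≤k (proj₂ (SameEdge⇒Pair≐ same y) (inj₂ refl))

  ν-splitEdge : ∀ {k} → 4 ≤ k → ν A k ≐ SplitEdge k
  ν-splitEdge {suc k} 4≤k@(s≤s (s≤s (s≤s (s≤s _)))) z =
    neighbour⇒split , λ z∈ → inj₂ (inj₁ (refl , z∈))
    where
    neighbour⇒split : ν A (suc k) z → SplitEdge (suc k) z
    neighbour⇒split (inj₁ (old , _)) = ⊥-elim (1+n≰n (proj₁ (cycleEdge-bounded k old)))
    neighbour⇒split (inj₂ (inj₁ (_ , z∈))) = z∈
    neighbour⇒split (inj₂ (inj₂ (refl , z∈))) = ⊥-elim (1+n≰n (splitEdge-< 4≤k z∈))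

  ν-dec : ∀ {k} → 4 ≤ k → ∀ z → Dec (ν A k z)
  ν-dec 4≤k z = map′ (proj₂ (ν-splitEdge 4≤k z)) (proj₁ (ν-splitEdge 4≤k z))
                     ((z ≟ _) ⊎-dec (z ≟ _))

  ν-cycleEdge : ∀ {k} → 4 ≤ k → SetIsCycleEdge A (pred k) (ν A k)
  ν-cycleEdge 4≤k = _ , _ , ν-splitEdge 4≤k , valid A _ 4≤k

  ν⇒cycleEdge : ∀ {k z} → 3 ≤ k → ν A k z → IsCycleEdge A k k z
  ν⇒cycleEdge (s≤s (s≤s (s≤s _))) z∈ = z∈

  cycleEdge⇒ν : ∀ {k m z} → 3 ≤ k → k ≤ m → z ≤ k → IsCycleEdge A m k z → ν A k z
  cycleEdge⇒ν 3≤k@(s≤s (s≤s (s≤s _))) k≤m z≤k e = cycleEdge-restrict 3≤k k≤m ≤-refl z≤k e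

  SetIsCycleEdge-ordered : ∀ {m S} → SetIsCycleEdge A m S →
    ∃[ lo ] ∃[ hi ] (lo < hi × S ≐ Pair lo hi × IsCycleEdge A m lo hi)
  SetIsCycleEdge-ordered {m} (x , y , S≐ , e) with <-cmp x y
  ... | tri< x<y _ _ = x , y , x<y , S≐ , e
  ... | tri≈ _ refl _ = ⊥-elim (cycleEdge-irrefl m e)
  ... | tri> _ _ y<x = y , x , y<x , ≐-trans S≐ Pair-comm , cycleEdge-sym m e

  SetIsCycleEdge-otherEnd : ∀ {m S k} → SetIsCycleEdge A m S → S k →
    ∃[ z ] (S z × IsCycleEdge A m k z)
  SetIsCycleEdge-otherEnd {m} (x , y , S≐ , e) k∈S with proj₁ (S≐ _) k∈S
  ... | inj₁ refl = y , proj₂ (S≐ y) (inj₂ refl) , e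
  ... | inj₂ refl = x , proj₂ (S≐ x) (inj₁ refl) , cycleEdge-sym m e

  SetIsCycleEdge⇒¬≐ν : ∀ {m S k} → SetIsCycleEdge A m S → 4 ≤ k → k ≤ m → ¬ (S ≐ ν A k)
  SetIsCycleEdge⇒¬≐ν {m} (x , y , S≐ , e) 4≤k k≤m S≐ν =
    cycleEdge-unsplit 4≤k k≤m e
      (Pair≐⇒SameEdge (λ { refl → cycleEdge-irrefl m e })
        (≐-trans (≐-sym S≐) (≐-trans S≐ν (ν-splitEdge 4≤k))))

  SetIsCycleEdge⇒¬Disjoint-ν : ∀ {m S k} → SetIsCycleEdge A m S → 3 ≤ k → k ≤ m →
    IsMax k S → ¬ Disjoint (ν A k) S
  SetIsCycleEdge⇒¬Disjoint-ν edgeS 3≤k k≤m (k∈S , max) disjoint =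
    let (z , z∈S , e) = SetIsCycleEdge-otherEnd edgeS k∈S in
    disjoint z (cycleEdge⇒ν 3≤k k≤m (max z z∈S) e) z∈S

IsVertex-swap : ∀ A B {n m} → IsVertex A B n m → IsVertex B A n m
IsVertex-swap A B (4≤m , m≤n , νA≢νB) = 4≤m , m≤n , λ νB≐νA → νA≢νB (≐-sym νB≐νA)

AdjCond-swap : ∀ A B {k m} → AdjCond A B k m → AdjCond B A k m
AdjCond-swap A B (inj₁ c) = inj₂ (inj₁ c)
AdjCond-swap A B (inj₂ (inj₁ c)) = inj₁ c
AdjCond-swap A B (inj₂ (inj₂ (inj₁ c))) = inj₂ (inj₂ (inj₂ c))
AdjCond-swap A B (inj₂ (inj₂ (inj₂ c))) = inj₂ (inj₂ (inj₁ c))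

PedEdge-swap : ∀ A B {n k m} → PedEdge B A n k m → PedEdge A B n k m
PedEdge-swap A B {k = k} {m} (k<m , k-vertex , m-vertex , adj) =
  k<m , IsVertex-swap B A k-vertex , IsVertex-swap B A m-vertex , AdjCond-swap B A {k} {m} adj

Isolated-swap : ∀ A B {n m} → Isolated A B n m → Isolated B A n m
Isolated-swap A B (vertex , noEdgeBelow , noEdgeAbove) =
  IsVertex-swap A B vertex ,
  (λ k edge → noEdgeBelow k (PedEdge-swap A B edge)) ,
  (λ k edge → noEdgeAbove k (PedEdge-swap A B edge))

crossEdges⇒isolated : ∀ A B {n} → 4 ≤ n →
  SetIsCycleEdge B n (ν A n) → SetIsCycleEdge A n (ν B n) → Isolated A B n n
crossEdges⇒isolated A B {n} 4≤n νA∈B νB∈A =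
  (4≤n , ≤-refl , SetIsCycleEdge⇒¬≐ν B νA∈B 4≤n ≤-refl) ,
  (λ k (k<n , (4≤k , _) , _ , adj) → notAdjacent 4≤k (<⇒≤ k<n) adj) ,
  (λ k (n<k , _ , (_ , k≤n , _) , _) → <⇒≱ n<k k≤n)
  where
  notAdjacent : ∀ {k} → 4 ≤ k → k ≤ n → ¬ AdjCond A B k n
  notAdjacent 4≤k k≤n (inj₁ νAn≐νBk) = SetIsCycleEdge⇒¬≐ν B νA∈B 4≤k k≤n νAn≐νBk
  notAdjacent 4≤k k≤n (inj₂ (inj₁ νBn≐νAk)) = SetIsCycleEdge⇒¬≐ν A νB∈A 4≤k k≤n νBn≐νAk
  notAdjacent 4≤k k≤n (inj₂ (inj₂ (inj₁ (max , disjoint)))) =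
    SetIsCycleEdge⇒¬Disjoint-ν B νA∈B (<⇒≤ 4≤k) k≤n max disjoint
  notAdjacent 4≤k k≤n (inj₂ (inj₂ (inj₂ (max , disjoint)))) =
    SetIsCycleEdge⇒¬Disjoint-ν A νB∈A (<⇒≤ 4≤k) k≤n max disjoint

module CrossEdge (A B : EvolvingCycle) {n : ℕ}
                 (4≤n : 4 ≤ n) (νA≢νB : ¬ (ν A n ≐ ν B n))
                 (noEdgeBelow : ∀ k → ¬ PedEdge A B n k n)
                 {lo hi : ℕ} (lo<hi : lo < hi) (νA≐ : ν A n ≐ Pair lo hi)
                 (edgeA : IsCycleEdge A (pred n) lo hi) where

  n-vertex : IsVertex A B n n
  n-vertex = 4≤n , ≤-refl , νA≢νB

  νB≢νA : ∀ {k} → 4 ≤ k → k ≤ n → ¬ (ν B k ≐ ν A n)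
  νB≢νA {k} 4≤k k≤n νB≐νA with m≤n⇒m<n∨m≡n k≤n
  ... | inj₂ refl = νA≢νB (≐-sym νB≐νA)
  ... | inj₁ k<n =
    noEdgeBelow k (k<n , (4≤k , k≤n , k-vertex) , n-vertex , inj₁ (≐-sym νB≐νA))
    where
    k-vertex : ¬ (ν A k ≐ ν B k)
    k-vertex νA≐νB = SetIsCycleEdge⇒¬≐ν A (ν-cycleEdge A 4≤n) 4≤k (<⇒≤pred k<n)
                       (≐-sym (≐-trans νA≐νB νB≐νA))

  crossEdge-from : ∀ {j} → 3 ≤ j → j < n → IsCycleEdge B j lo hi → IsCycleEdge B n lo hi
  crossEdge-from {j} 3≤j j<n e = cycleEdge-persist B 3≤j (<⇒≤ j<n) e unsplit
    where
    unsplit : ∀ {k} → j < k → k ≤ n → ¬ SameEdge (ins B k) lo hi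
    unsplit j<k k≤n same = νB≢νA 4≤k k≤n
      (≐-trans (ν-splitEdge B 4≤k) (≐-trans (SameEdge⇒Pair≐ same) (≐-sym νA≐)))
      where
      4≤k : 4 ≤ _
      4≤k = ≤-trans (s≤s 3≤j) j<k

  hi<n : hi < n
  hi<n = splitEdge-< A 4≤n (proj₁ (ν-splitEdge A 4≤n hi) (proj₂ (νA≐ hi) (inj₂ refl)))

  crossEdge-via-hi : 4 ≤ hi → IsCycleEdge B n lo hi
  crossEdge-via-hi 4≤hi with ν-dec B 4≤hi lo
  ... | yes lo∈νBhi = crossEdge-from (<⇒≤ 4≤hi) hi<n
        (cycleEdge-sym B hi (ν⇒cycleEdge B (<⇒≤ 4≤hi) lo∈νBhi))
  ... | no lo∉νBhi = ⊥-elim (noEdgeBelow hi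
        (hi<n , (4≤hi , <⇒≤ hi<n , hi-vertex) , n-vertex ,
         inj₂ (inj₂ (inj₁ (hi-max , disjoint)))))
    where
    hi-vertex : ¬ (ν A hi ≐ ν B hi)
    hi-vertex νA≐νB = lo∉νBhi (proj₁ (νA≐νB lo)
      (cycleEdge⇒ν A (<⇒≤ 4≤hi) (<⇒≤pred hi<n) (<⇒≤ lo<hi)
                   (cycleEdge-sym A (pred n) edgeA)))
    hi-max : IsMax hi (ν A n)
    hi-max = proj₂ (νA≐ hi) (inj₂ refl)
           , λ z z∈ → Pair-≤ (<⇒≤ lo<hi , ≤-refl) (proj₁ (νA≐ z) z∈)
    disjoint : Disjoint (ν B hi) (ν A n)
    disjoint z z∈νBhi z∈νAn with proj₁ (νA≐ z) z∈νAn
    ... | inj₁ refl = lo∉νBhi z∈νBhi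
    ... | inj₂ refl = cycleEdge-irrefl B hi (ν⇒cycleEdge B (<⇒≤ 4≤hi) z∈νBhi)

  crossEdge : IsCycleEdge B n lo hi
  crossEdge with hi ≤? 3
  -- A_3 and B_3 are the same triangle, so the restricted A-edge is a B-edge.
  ... | yes hi≤3 = crossEdge-from ≤-refl 4≤n
        (cycleEdge-restrict A ≤-refl (pred-mono-≤ 4≤n) (<⇒≤ (<-≤-trans lo<hi hi≤3)) hi≤3
                            edgeA)
  ... | no hi≰3 = crossEdge-via-hi (≰⇒> hi≰3)

isolated⇒crossEdge : ∀ A B {n} → Isolated A B n n → SetIsCycleEdge B n (ν A n)
isolated⇒crossEdge A B ((4≤n , _ , νA≢νB) , noEdgeBelow , _)
  with SetIsCycleEdge-ordered A (ν-cycleEdge A 4≤n)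
... | lo , hi , lo<hi , νA≐ , edgeA =
  lo , hi , νA≐ , CrossEdge.crossEdge A B 4≤n νA≢νB noEdgeBelow lo<hi νA≐ edgeA

lemma5 : (A B : EvolvingCycle) (n : ℕ) → 4 ≤ n →
    Isolated A B n n ⇔ (SetIsCycleEdge B n (ν A n) × SetIsCycleEdge A n (ν B n))
lemma5 A B n 4≤n = mk⇔
  (λ iso → isolated⇒crossEdge A B iso , isolated⇒crossEdge B A (Isolated-swap A B iso))
  (λ (νA∈B , νB∈A) → crossEdges⇒isolated A B 4≤n νA∈B νB∈A)
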